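{- Let $\Lambda$ be an ordinal, let $A,B$ be worms of $\mathsf{GLP}_\Lambda$ and let $\varphi$ be a $\mathsf{GLP}_\Lambda$ formula. If $\vdash_{\mathsf{GLP}_\Lambda}A\to B$, then $\vdash_{\mathsf{GLP}_\Lambda}Q(A,\varphi)\to Q(B,\varphi)$.
   Context: For an ordinal $\Lambda$, $\mathsf{GLP}_\Lambda$ is the propositional polymodal logic with modalities $[\xi]$, $\xi<\Lambda$ ($\langle\xi\rangle:=\neg[\xi]\neg$), axiomatized by propositional tautologies; $[\xi](\varphi\to\psi)\to([\xi]\varphi\to[\xi]\psi)$; $[\xi]\varphi\to[\xi][\xi]\varphi$; $[\xi]([\xi]\varphi\to\varphi)\to[\xi]\varphi$; $\langle\zeta\rangle\varphi\to\langle\xi\rangle\varphi$ and $\langle\xi\rangle\varphi\to[\zeta]\langle\xi\rangle\varphi$ for $\xi<\zeta<\Lambda$; rules modus ponens and necessitation for each $[\xi]$. Worms are defined inductively: $\top$ is a worm, and if $A$ is a worm and $\gamma<\Lambda$ then $\langle\gamma\rangle A$ is a worm. For a worm and a formula $\varphi$: $Q(\top,\varphi)=\top$ and $Q(\langle\gamma\rangle A,\varphi)=\langle\gamma\rangle(\varphi\wedge Q(A,\varphi))$. -}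

module Defs where

open import Data.Nat using (ℕ)
open import Data.Bool using (Bool; true; false; not; _∧_; _∨_)
open import Relation.Binary.PropositionalEquality using (_≡_)
open import Relation.Binary.Core using (Rel)
open import Relation.Binary.Structures using (IsStrictTotalOrder)
open import Induction.WellFounded using (WellFounded)

-- An ordinal Λ, presented as a well-ordered set: a strict total order that
-- is well-founded.  Its elements are the modality indices ξ < Λ.
record Ordinal : Set₁ where
  field
    Carrier            : Set
    _≺_                : Rel Carrier _
    isStrictTotalOrder : IsStrictTotalOrder _≡_ _≺_
    wellFounded        : WellFounded _≺_

module GLP (Λ : Ordinal) where
  open Ordinal Λ

  infixr 4 _⇒_
  data Fm : Set where
    var : ℕ → Fm
    ⊥'  : Fm
    _⇒_ : Fm → Fm → Fm
    [_] : Carrier → Fm → Fm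

  ¬' : Fm → Fm
  ¬' φ = φ ⇒ ⊥'

  ⊤' : Fm
  ⊤' = ¬' ⊥'

  _∧'_ : Fm → Fm → Fm
  φ ∧' ψ = ¬' (φ ⇒ ¬' ψ)

  ⟨_⟩ : Carrier → Fm → Fm
  ⟨ ξ ⟩ φ = ¬' ([ ξ ] (¬' φ))

  eval : (ℕ → Bool) → (Carrier → Fm → Bool) → Fm → Bool
  eval v b (var n)   = v n
  eval v b ⊥'        = false
  eval v b (φ ⇒ ψ)   = not (eval v b φ) ∨ eval v b ψ
  eval v b ([ ξ ] φ) = b ξ φ

  -- Propositional tautologies (instances of tautologies in the modal language).
  Tautology : Fm → Set
  Tautology φ = ∀ (v : ℕ → Bool) (b : Carrier → Fm → Bool) → eval v b φ ≡ true

  data ⊢_ : Fm → Set where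
    taut  : ∀ {φ} → Tautology φ → ⊢ φ
    axK   : ∀ ξ φ ψ → ⊢ ([ ξ ] (φ ⇒ ψ) ⇒ [ ξ ] φ ⇒ [ ξ ] ψ)
    ax4   : ∀ ξ φ → ⊢ ([ ξ ] φ ⇒ [ ξ ] ([ ξ ] φ))
    axL   : ∀ ξ φ → ⊢ ([ ξ ] ([ ξ ] φ ⇒ φ) ⇒ [ ξ ] φ)
    axMon : ∀ ξ ζ φ → ξ ≺ ζ → ⊢ (⟨ ζ ⟩ φ ⇒ ⟨ ξ ⟩ φ)
    axNeg : ∀ ξ ζ φ → ξ ≺ ζ → ⊢ (⟨ ξ ⟩ φ ⇒ [ ζ ] (⟨ ξ ⟩ φ))
    mp    : ∀ {φ ψ} → ⊢ (φ ⇒ ψ) → ⊢ φ → ⊢ ψ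
    nec   : ∀ ξ {φ} → ⊢ φ → ⊢ ([ ξ ] φ)

  data Worm : Set where
    top  : Worm
    dia  : Carrier → Worm → Worm

  ⌜_⌝ : Worm → Fm
  ⌜ top ⌝     = ⊤'
  ⌜ dia γ A ⌝ = ⟨ γ ⟩ ⌜ A ⌝

  Q : Worm → Fm → Fm
  Q top       φ = ⊤'
  Q (dia γ A) φ = ⟨ γ ⟩ (φ ∧' Q A φ)

module Submission where

open import Defs
open import Data.Bool using (Bool; true; false; not; _∨_)
open import Relation.Binary.PropositionalEquality using (_≡_; refl; trans; cong₂)

-- Relativise every box to φ: the translation ψ ↦ ψᶲ replacing [ξ]χ by
-- [ξ](φ → χᶲ) sends theorems of GLP_Λ to theorems, because the translation of
-- each axiom follows propositionally from an instance of the same axiom.  The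
-- translation of the worm ⟨γ⟩A is ¬[γ](φ → ¬Aᶲ), which is equivalent to
-- ⟨γ⟩(φ ∧ Aᶲ); so by induction ⌜A⌝ᶲ is equivalent to Q(A,φ), and translating
-- ⊢ A → B yields ⊢ Q(A,φ) → Q(B,φ).

infixr 4 _⇒ᵇ_

_⇒ᵇ_ : Bool → Bool → Bool
x ⇒ᵇ y = not x ∨ y

⇒ᵇ-refl : ∀ x → (x ⇒ᵇ x) ≡ true
⇒ᵇ-refl true  = refl
⇒ᵇ-refl false = refl

⇒ᵇ-K : ∀ x y → (x ⇒ᵇ y ⇒ᵇ x) ≡ true
⇒ᵇ-K true  true  = refl
⇒ᵇ-K true  false = refl
⇒ᵇ-K false y     = refl

⇒ᵇ-S : ∀ x y z → ((x ⇒ᵇ y ⇒ᵇ z) ⇒ᵇ (x ⇒ᵇ y) ⇒ᵇ x ⇒ᵇ z) ≡ true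
⇒ᵇ-S true  true  true  = refl
⇒ᵇ-S true  true  false = refl
⇒ᵇ-S true  false z     = refl
⇒ᵇ-S false y     z     = refl

⇒ᵇ-exchange : ∀ x y z → ((x ⇒ᵇ y ⇒ᵇ z) ⇒ᵇ y ⇒ᵇ x ⇒ᵇ z) ≡ true
⇒ᵇ-exchange true  true  true  = refl
⇒ᵇ-exchange true  true  false = refl
⇒ᵇ-exchange true  false z     = refl
⇒ᵇ-exchange false true  z     = refl
⇒ᵇ-exchange false false z     = refl

⇒ᵇ-contrapose : ∀ x y → ((x ⇒ᵇ y) ⇒ᵇ (y ⇒ᵇ false) ⇒ᵇ x ⇒ᵇ false) ≡ true
⇒ᵇ-contrapose true  true  = refl
⇒ᵇ-contrapose true  false = refl
⇒ᵇ-contrapose false true  = refl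
⇒ᵇ-contrapose false false = refl

¬¬ᵇ-elim : ∀ x → (((x ⇒ᵇ false) ⇒ᵇ false) ⇒ᵇ x) ≡ true
¬¬ᵇ-elim true  = refl
¬¬ᵇ-elim false = refl

¬¬ᵇ-intro : ∀ x → (x ⇒ᵇ (x ⇒ᵇ false) ⇒ᵇ false) ≡ true
¬¬ᵇ-intro true  = refl
¬¬ᵇ-intro false = refl

module _ {Λ : Ordinal} where
  open GLP Λ

  ⇒-refl : ∀ a → ⊢ (a ⇒ a)
  ⇒-refl a = taut λ v β → ⇒ᵇ-refl (eval v β a)

  ⇒-K : ∀ a b → ⊢ (a ⇒ b ⇒ a)
  ⇒-K a b = taut λ v β → ⇒ᵇ-K (eval v β a) (eval v β b)

  ⇒-S : ∀ a b c → ⊢ ((a ⇒ b ⇒ c) ⇒ (a ⇒ b) ⇒ a ⇒ c)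
  ⇒-S a b c = taut λ v β → ⇒ᵇ-S (eval v β a) (eval v β b) (eval v β c)

  ⇒-exchange : ∀ a b c → ⊢ ((a ⇒ b ⇒ c) ⇒ b ⇒ a ⇒ c)
  ⇒-exchange a b c = taut λ v β → ⇒ᵇ-exchange (eval v β a) (eval v β b) (eval v β c)

  ¬¬-elim : ∀ a → ⊢ (¬' (¬' a) ⇒ a)
  ¬¬-elim a = taut λ v β → ¬¬ᵇ-elim (eval v β a)

  ¬¬-intro : ∀ a → ⊢ (a ⇒ ¬' (¬' a))
  ¬¬-intro a = taut λ v β → ¬¬ᵇ-intro (eval v β a)

  contrapose : ∀ {a b} → ⊢ (a ⇒ b) → ⊢ (¬' b ⇒ ¬' a)
  contrapose {a} {b} = mp (taut λ v β → ⇒ᵇ-contrapose (eval v β a) (eval v β b))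

  ⇒-weaken : ∀ {b} a → ⊢ b → ⊢ (a ⇒ b)
  ⇒-weaken {b} a = mp (⇒-K b a)

  ⇒-monoʳ : ∀ {b c} a → ⊢ (b ⇒ c) → ⊢ ((a ⇒ b) ⇒ (a ⇒ c))
  ⇒-monoʳ {b} {c} a p = mp (⇒-S a b c) (⇒-weaken a p)

  ⇒-trans : ∀ {a b c} → ⊢ (a ⇒ b) → ⊢ (b ⇒ c) → ⊢ (a ⇒ c)
  ⇒-trans {a} p q = mp (⇒-monoʳ a q) p

  []-mono : ∀ ξ {a b} → ⊢ (a ⇒ b) → ⊢ ([ ξ ] a ⇒ [ ξ ] b)
  []-mono ξ {a} {b} p = mp (axK ξ a b) (nec ξ p)

  ¬[]-antitone : ∀ ξ {a b} → ⊢ (a ⇒ b) → ⊢ (¬' ([ ξ ] b) ⇒ ¬' ([ ξ ] a))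
  ¬[]-antitone ξ p = contrapose ([]-mono ξ p)

  ¬[]⇒⟨⟩¬ : ∀ ξ a → ⊢ (¬' ([ ξ ] a) ⇒ ⟨ ξ ⟩ (¬' a))
  ¬[]⇒⟨⟩¬ ξ a = ¬[]-antitone ξ (¬¬-elim a)

  ⟨⟩¬⇒¬[] : ∀ ξ a → ⊢ (⟨ ξ ⟩ (¬' a) ⇒ ¬' ([ ξ ] a))
  ⟨⟩¬⇒¬[] ξ a = ¬[]-antitone ξ (¬¬-intro a)

  module _ (φ : Fm) where

    relativize : Fm → Fm
    relativize (var n)   = var n
    relativize ⊥'        = ⊥'
    relativize (a ⇒ b)   = relativize a ⇒ relativize b
    relativize ([ ξ ] a) = [ ξ ] (φ ⇒ relativize a)

    eval-relativize : ∀ v β ψ →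
      eval v β (relativize ψ) ≡ eval v (λ ξ χ → β ξ (φ ⇒ relativize χ)) ψ
    eval-relativize v β (var n)   = refl
    eval-relativize v β ⊥'        = refl
    eval-relativize v β (a ⇒ b)   =
      cong₂ _⇒ᵇ_ (eval-relativize v β a) (eval-relativize v β b)
    eval-relativize v β ([ ξ ] a) = refl

    relativize-sound : ∀ {ψ} → ⊢ ψ → ⊢ relativize ψ
    relativize-sound {ψ} (taut T) = taut λ v β → trans (eval-relativize v β ψ) (T v _)
    relativize-sound (axK ξ a b) =
      ⇒-trans ([]-mono ξ (⇒-S φ (relativize a) (relativize b)))
              (axK ξ (φ ⇒ relativize a) (φ ⇒ relativize b))
    relativize-sound (ax4 ξ a) =
      ⇒-trans (ax4 ξ (φ ⇒ relativize a))
              ([]-mono ξ (⇒-K ([ ξ ] (φ ⇒ relativize a)) φ))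
    relativize-sound (axL ξ a) =
      ⇒-trans ([]-mono ξ (⇒-exchange φ ([ ξ ] (φ ⇒ relativize a)) (relativize a)))
              (axL ξ (φ ⇒ relativize a))
    relativize-sound (axMon ξ ζ a ξ≺ζ) =
      ⇒-trans (¬[]⇒⟨⟩¬ ζ _) (⇒-trans (axMon ξ ζ _ ξ≺ζ) (⟨⟩¬⇒¬[] ξ _))
    relativize-sound (axNeg ξ ζ a ξ≺ζ) =
      ⇒-trans (¬[]⇒⟨⟩¬ ξ _)
              (⇒-trans (axNeg ξ ζ _ ξ≺ζ) ([]-mono ζ (⇒-trans (⟨⟩¬⇒¬[] ξ _) (⇒-K _ φ))))
    relativize-sound (mp p q) = mp (relativize-sound p) (relativize-sound q)
    relativize-sound (nec ξ p) = nec ξ (⇒-weaken φ (relativize-sound p))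

    -- Both directions go through ⟨γ⟩(φ ∧ χ) = ¬[γ]¬¬(φ → ¬χ).
    Q⇒relativize : ∀ A → ⊢ (Q A φ ⇒ relativize ⌜ A ⌝)
    Q⇒relativize top       = ⇒-refl ⊤'
    Q⇒relativize (dia γ A) =
      ¬[]-antitone γ
        (⇒-trans (⇒-monoʳ φ (contrapose (Q⇒relativize A))) (¬¬-intro _))

    relativize⇒Q : ∀ A → ⊢ (relativize ⌜ A ⌝ ⇒ Q A φ)
    relativize⇒Q top       = ⇒-refl ⊤'
    relativize⇒Q (dia γ A) =
      ¬[]-antitone γ
        (⇒-trans (¬¬-elim _) (⇒-monoʳ φ (contrapose (relativize⇒Q A))))

lemma2 : (Λ : Ordinal) → let open GLP Λ in
    (A B : Worm) (φ : Fm) →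
    ⊢ (⌜ A ⌝ ⇒ ⌜ B ⌝) →
    ⊢ (Q A φ ⇒ Q B φ)
lemma2 Λ A B φ A⇒B =
  ⇒-trans (Q⇒relativize φ A) (⇒-trans (relativize-sound φ A⇒B) (relativize⇒Q φ B))
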